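{- If $\alpha\le\beta<\epsilon_0$ are ordinals, then $\alpha\sqsubseteq\beta$.
   Context: A formal sum $\gamma+\alpha$ of ordinals below $\epsilon_0$ is a Cantor sum if the Cantor normal form of $\gamma+\alpha$ is $\gamma_1+\cdots+\gamma_m+\alpha$ where $\gamma_1+\cdots+\gamma_m$ is the Cantor normal form of $\gamma$. The relation $\sqsubseteq$ on ordinals $<\epsilon_0$ is the least relation such that: (1) $\alpha\sqsubseteq\alpha$; (2) $\alpha\sqsubseteq\beta\sqsubseteq\gamma$ implies $\alpha\sqsubseteq\gamma$; (3) $\alpha\sqsubseteq\alpha+1$; (4) $\omega^\alpha\cdot k\sqsubseteq\omega^{\alpha+1}$ for every $k<\omega$; (5) if $\alpha\sqsubseteq\beta$ then $\gamma+\alpha\sqsubseteq\gamma+\beta$ whenever $\gamma+\alpha$ and $\gamma+\beta$ are Cantor sums; (6) if $\alpha\sqsubseteq\beta$ then $\omega^\alpha\sqsubseteq\omega^\beta$. -}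

module Defs where

open import Data.Nat using (ℕ; zero; suc)
open import Data.Sum using (_⊎_)
open import Relation.Binary.PropositionalEquality using (_≡_)

-- Ordinals below ε₀ in (hereditary) Cantor normal form.
-- A term  ω^ a + b  denotes  ω^a + b ; a normal form is ω^a₁ + (ω^a₂ + (… + 𝟎))
-- with a₁ ≥ a₂ ≥ … and every aᵢ itself in normal form.
data Tm : Set where
  𝟎    : Tm
  ω^_+_ : Tm → Tm → Tm

infixr 30 ω^_+_

data _<_ : Tm → Tm → Set where
  <₀ : ∀ {a b} → 𝟎 < ω^ a + b
  <₁ : ∀ {a b c d} → a < c → ω^ a + b < ω^ c + d
  <₂ : ∀ {a b d} → b < d → ω^ a + b < ω^ a + d

infix 4 _<_ _≤_ _⊑_

_≤_ : Tm → Tm → Set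
a ≤ b = a < b ⊎ a ≡ b

data _≤head_ : Tm → Tm → Set where
  zero≤ : ∀ {a} → 𝟎 ≤head a
  term≤ : ∀ {a c d} → c ≤ a → (ω^ c + d) ≤head a

data IsNF : Tm → Set where
  nf𝟎 : IsNF 𝟎
  nfω : ∀ {a b} → IsNF a → IsNF b → b ≤head a → IsNF (ω^ a + b)

data Cmp : Set where
  lt eq gt : Cmp

compare : Tm → Tm → Cmp
compare 𝟎 𝟎 = eq
compare 𝟎 (ω^ _ + _) = lt
compare (ω^ _ + _) 𝟎 = gt
compare (ω^ a + b) (ω^ c + d) with compare a c
... | lt = lt
... | gt = gt
... | eq = compare b d

_⊕_ : Tm → Tm → Tm
𝟎 ⊕ β = β
(ω^ a + b) ⊕ 𝟎 = ω^ a + b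
(ω^ a + b) ⊕ (ω^ c + d) with compare a c
... | lt = ω^ c + d
... | eq = ω^ a + (b ⊕ (ω^ c + d))
... | gt = ω^ a + (b ⊕ (ω^ c + d))

infixl 20 _⊕_

_++ₜ_ : Tm → Tm → Tm
𝟎 ++ₜ β = β
(ω^ a + b) ++ₜ β = ω^ a + (b ++ₜ β)

CantorSum : Tm → Tm → Set
CantorSum γ α = γ ⊕ α ≡ γ ++ₜ α

one : Tm
one = ω^ 𝟎 + 𝟎

ω^⟨_⟩ : Tm → Tm
ω^⟨ a ⟩ = ω^ a + 𝟎

ω^⟨_⟩·_ : Tm → ℕ → Tm
ω^⟨ a ⟩· zero = 𝟎
ω^⟨ a ⟩· suc k = ω^ a + (ω^⟨ a ⟩· k)

data _⊑_ : Tm → Tm → Set where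
  ⊑-refl  : ∀ {α} → IsNF α → α ⊑ α
  ⊑-trans : ∀ {α β γ} → α ⊑ β → β ⊑ γ → α ⊑ γ
  ⊑-suc   : ∀ {α} → IsNF α → α ⊑ α ⊕ one
  ⊑-ωk    : ∀ {α} → IsNF α → (k : ℕ) → (ω^⟨ α ⟩· k) ⊑ ω^⟨ α ⊕ one ⟩
  ⊑-sum   : ∀ {γ α β} → IsNF γ → α ⊑ β → CantorSum γ α → CantorSum γ β →
            γ ⊕ α ⊑ γ ⊕ β
  ⊑-exp   : ∀ {α β} → α ⊑ β → ω^⟨ α ⟩ ⊑ ω^⟨ β ⟩

module Submission where

-- Call β complete if every normal form α ≤ β has α ⊑ β.  The proof shows that
-- every β is complete, by structural recursion on the leading exponent b of β:
-- assuming all normal forms ≤ b are complete, every x < ω^(b+1) is complete.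
-- The heart of this step is that a term x with exponents ≤ a ≤ b lies ⊑-below
-- some multiple ω^a·k (peeling x term by term, and climbing from a smaller
-- exponent a' < a via ω^a'·k ⊑ ω^(a'+1) ⊑ ω^a, where a'+1 ⊑ a by hypothesis).
-- Then α < x = ω^b' + d' is handled by comparing leading terms: if α's leading
-- exponent is smaller, α ⊑ ω^b' ⊑ x; otherwise α and x share the leading term
-- and the claim reduces to the tails, by closure of ⊑ under Cantor sums.

open import Defs
open import Data.Nat using (zero; suc)
open import Data.Sum using (inj₁; inj₂)
open import Data.Product using (∃; _,_)
open import Relation.Binary.PropositionalEquality using (_≡_; _≢_; refl; subst₂)

<-trans : ∀ {x y z} → x < y → y < z → x < z
<-trans <₀ (<₁ _) = <₀
<-trans <₀ (<₂ _) = <₀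
<-trans (<₁ p) (<₁ q) = <₁ (<-trans p q)
<-trans (<₁ p) (<₂ _) = <₁ p
<-trans (<₂ _) (<₁ q) = <₁ q
<-trans (<₂ p) (<₂ q) = <₂ (<-trans p q)

≤-trans : ∀ {x y z} → x ≤ y → y ≤ z → x ≤ z
≤-trans (inj₁ p) (inj₁ q) = inj₁ (<-trans p q)
≤-trans (inj₁ p) (inj₂ refl) = inj₁ p
≤-trans (inj₂ refl) q = q

𝟎≤ : ∀ x → 𝟎 ≤ x
𝟎≤ 𝟎 = inj₂ refl
𝟎≤ (ω^ _ + _) = inj₁ <₀

≤𝟎⇒≡𝟎 : ∀ {x} → x ≤ 𝟎 → x ≡ 𝟎
≤𝟎⇒≡𝟎 (inj₁ ())
≤𝟎⇒≡𝟎 (inj₂ e) = e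

≤head-weaken : ∀ {x a b} → x ≤head a → a ≤ b → x ≤head b
≤head-weaken zero≤ _ = zero≤
≤head-weaken (term≤ p) q = term≤ (≤-trans p q)

≤⇒≤head : ∀ {x b d} → x ≤ ω^ b + d → x ≤head b
≤⇒≤head {𝟎} _ = zero≤
≤⇒≤head {ω^ _ + _} (inj₂ refl) = term≤ (inj₂ refl)
≤⇒≤head {ω^ _ + _} (inj₁ (<₁ p)) = term≤ (inj₁ p)
≤⇒≤head {ω^ _ + _} (inj₁ (<₂ _)) = term≤ (inj₂ refl)

compare-refl : ∀ a → compare a a ≡ eq
compare-refl 𝟎 = refl
compare-refl (ω^ a + b) rewrite compare-refl a = compare-refl b

compare-gt : ∀ {a c} → c < a → compare a c ≡ gt
compare-gt <₀ = refl
compare-gt (<₁ p) rewrite compare-gt p = refl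
compare-gt (<₂ {a} p) rewrite compare-refl a = compare-gt p

compare-≥ : ∀ {a c} → c ≤ a → compare a c ≢ lt
compare-≥ {a} (inj₂ refl) rewrite compare-refl a = λ ()
compare-≥ (inj₁ p) rewrite compare-gt p = λ ()

cantorSum-ω^ : ∀ a y → y ≤head a → CantorSum ω^⟨ a ⟩ y
cantorSum-ω^ a 𝟎 _ = refl
cantorSum-ω^ a (ω^ c + d) (term≤ c≤a) with compare a c in eqn
... | lt with () ← compare-≥ c≤a eqn
... | eq = refl
... | gt = refl

⊕one-step : ∀ x y → (ω^ x + y) ⊕ one ≡ ω^ x + (y ⊕ one)
⊕one-step 𝟎 _ = refl
⊕one-step (ω^ _ + _) _ = refl

<⇒⊕one≤ : ∀ {a c} → a < c → a ⊕ one ≤ c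
<⇒⊕one≤ {𝟎} {ω^ 𝟎 + 𝟎} <₀ = inj₂ refl
<⇒⊕one≤ {𝟎} {ω^ 𝟎 + (ω^ _ + _)} <₀ = inj₁ (<₂ <₀)
<⇒⊕one≤ {𝟎} {ω^ (ω^ _ + _) + _} <₀ = inj₁ (<₁ <₀)
<⇒⊕one≤ {ω^ x + y} (<₁ p) rewrite ⊕one-step x y = inj₁ (<₁ p)
<⇒⊕one≤ {ω^ x + y} (<₂ p) rewrite ⊕one-step x y with <⇒⊕one≤ p
... | inj₁ q = inj₁ (<₂ q)
... | inj₂ refl = inj₂ refl

nf-⊕one : ∀ {a} → IsNF a → IsNF (a ⊕ one)
nf-⊕one nf𝟎 = nfω nf𝟎 nf𝟎 zero≤
nf-⊕one (nfω {x} {y} nx ny h) rewrite ⊕one-step x y = nfω nx (nf-⊕one ny) (head h)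
  where
  head : ∀ {y} → y ≤head x → (y ⊕ one) ≤head x
  head {𝟎} _ = term≤ (𝟎≤ x)
  head {ω^ p + q} (term≤ r) rewrite ⊕one-step p q = term≤ r

ω^·-≤head : ∀ a k → (ω^⟨ a ⟩· k) ≤head a
ω^·-≤head a zero = zero≤
ω^·-≤head a (suc k) = term≤ (inj₂ refl)

⊑-prefix : ∀ {a c y} → IsNF a → c ≤head a → y ≤head a → c ⊑ y →
           ω^ a + c ⊑ ω^ a + y
⊑-prefix {a} {c} {y} na hc hy c⊑y =
  subst₂ _⊑_ (cantorSum-ω^ a c hc) (cantorSum-ω^ a y hy)
    (⊑-sum (nfω na nf𝟎 zero≤) c⊑y (cantorSum-ω^ a c hc) (cantorSum-ω^ a y hy))

-- 𝟎 is ⊑-below every normal form: 𝟎 ⊑ 1 = ω^𝟎 ⊑ ω^a ⊑ ω^a + c.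
𝟎⊑ : ∀ {x} → IsNF x → 𝟎 ⊑ x
𝟎⊑ nf𝟎 = ⊑-refl nf𝟎
𝟎⊑ (nfω na nc h) =
  ⊑-trans (⊑-trans (⊑-suc nf𝟎) (⊑-exp (𝟎⊑ na))) (⊑-prefix na zero≤ h (𝟎⊑ nc))

ω^⊑ω^+ : ∀ {a c} → IsNF a → IsNF c → c ≤head a → ω^⟨ a ⟩ ⊑ ω^ a + c
ω^⊑ω^+ na nc h = ⊑-prefix na zero≤ h (𝟎⊑ nc)

⊑-multiple-step : ∀ {a c k} → IsNF a → c ≤head a → c ⊑ ω^⟨ a ⟩· k →
                  ω^ a + c ⊑ ω^⟨ a ⟩· suc k
⊑-multiple-step {a} {k = k} na hc c⊑ω^ak = ⊑-prefix na hc (ω^·-≤head a k) c⊑ω^ak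

Complete : Tm → Set
Complete β = ∀ α → IsNF α → α ≤ β → α ⊑ β

CompleteUpTo : Tm → Set
CompleteUpTo b = ∀ y → IsNF y → y ≤ b → Complete y

complete-𝟎 : Complete 𝟎
complete-𝟎 α _ α≤𝟎 rewrite ≤𝟎⇒≡𝟎 α≤𝟎 = ⊑-refl nf𝟎

module _ {b : Tm} (upTo-b : CompleteUpTo b) where

  -- For a' < a ≤ b, every multiple of ω^a' is ⊑-below ω^a:
  -- ω^a'·k ⊑ ω^(a'+1) by rule (4), and a'+1 ⊑ a since a is complete.
  multiple⊑power : ∀ {a' a} → IsNF a' → IsNF a → a' < a → a ≤ b →
                   ∀ k → ω^⟨ a' ⟩· k ⊑ ω^⟨ a ⟩
  multiple⊑power na' na a'<a a≤b k =
    ⊑-trans (⊑-ωk na' k)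
            (⊑-exp (upTo-b _ na a≤b _ (nf-⊕one na') (<⇒⊕one≤ a'<a)))

  ⊑-multiple : ∀ {x a} → IsNF x → IsNF a → x ≤head a → a ≤ b →
               ∃ λ k → x ⊑ ω^⟨ a ⟩· k
  ⊑-multiple nf𝟎 _ _ _ = 0 , ⊑-refl nf𝟎
  ⊑-multiple (nfω {a'} na' nc hc) na (term≤ a'≤a) a≤b
    with ⊑-multiple nc na' hc (≤-trans a'≤a a≤b) | a'≤a
  ... | k , c⊑ω^a'k | inj₂ refl = suc k , ⊑-multiple-step na' hc c⊑ω^a'k
  ... | k , c⊑ω^a'k | inj₁ a'<a =
    1 , ⊑-trans (⊑-multiple-step na' hc c⊑ω^a'k) (multiple⊑power na' na a'<a a≤b (suc k))

  -- For α < x = ω^b' + d':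
  -- α = 𝟎 is handled by 𝟎⊑; a smaller leading exponent a < b' gives
  -- α ⊑ ω^a·k ⊑ ω^b' ⊑ x; an equal leading term reduces to the tails.
  complete-below : ∀ {x} → IsNF x → x ≤head b → Complete x
  complete-below nf𝟎 _ = complete-𝟎
  complete-below nx _ α _ (inj₂ refl) = ⊑-refl nx
  complete-below nx _ .𝟎 _ (inj₁ <₀) = 𝟎⊑ nx
  complete-below (nfω nb' nd' hd') (term≤ b'≤b) (ω^ a + c) nα@(nfω na _ _) (inj₁ (<₁ a<b'))
    with ⊑-multiple nα na (term≤ (inj₂ refl)) (≤-trans (inj₁ a<b') b'≤b)
  ... | k , α⊑ω^ak =
    ⊑-trans (⊑-trans α⊑ω^ak (multiple⊑power na nb' a<b' b'≤b k)) (ω^⊑ω^+ nb' nd' hd')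
  complete-below (nfω nb' nd' hd') (term≤ b'≤b) (ω^ _ + c) (nfω _ nc hc) (inj₁ (<₂ c<d')) =
    ⊑-prefix nb' hc hd'
      (complete-below nd' (≤head-weaken hd' b'≤b) c nc (inj₁ c<d'))

completeUpTo : ∀ b → CompleteUpTo b
completeUpTo 𝟎 y _ y≤𝟎 rewrite ≤𝟎⇒≡𝟎 y≤𝟎 = complete-𝟎
completeUpTo (ω^ b + _) _ ny y≤β = complete-below (completeUpTo b) ny (≤⇒≤head y≤β)

mainTheorem3 : (α β : Tm) → IsNF α → IsNF β → α ≤ β → α ⊑ β
mainTheorem3 α β nα nβ α≤β = completeUpTo β β nβ (inj₂ refl) α nα α≤β
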